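{- Let $\Gamma=D[A\otimes(B\otimes C)]$ be a binary sequent, where $D[\cdot]$ is a context (a sequent with a hole in one of its formulas), and let $\Gamma_1=D[A\otimes(B⅋C)]$ and $\Gamma_2=D[A⅋(B\otimes C)]$. Then (1) for $i=1,2$, $\vdash\Gamma\multimap\Gamma_i$ is provable in MLL+MIX; and (2) $\vdash\Gamma$ is provable in MLL+MIX if and only if both $\vdash\Gamma_1$ and $\vdash\Gamma_2$ are.
   Context: MLL+MIX formulas are built from propositional atoms $\alpha$ and their negations $\alpha^\perp$ by $\otimes$ and $⅋$; linear negation extends by De Morgan: $(A\otimes B)^\perp=A^\perp⅋B^\perp$, $(A⅋B)^\perp=A^\perp\otimes B^\perp$, $\alpha^{\perp\perp}=\alpha$; $A\multimap B=A^\perp⅋B$. For sequents, $\Gamma\multimap\Delta$ means the formula $(⅋\Gamma)\multimap(⅋\Delta)$, $⅋\Gamma$ being the $⅋$ of the formulas of $\Gamma$. Rules: Identity $\vdash\alpha^\perp,\alpha$; Cut from $\vdash\Gamma,A$ and $\vdash\Delta,A^\perp$ infer $\vdash\Gamma,\Delta$; Exchange (permute a sequent); Mix from $\vdash\Gamma$ and $\vdash\Delta$ infer $\vdash\Gamma,\Delta$; Tensor from $\vdash\Gamma,A$ and $\vdash\Delta,B$ infer $\vdash\Gamma,\Delta,A\otimes B$; Par from $\vdash\Gamma,A,B$ infer $\vdash\Gamma,A⅋B$. A sequent is binary if each atom occurring in it occurs exactly once as $\alpha$ and exactly once as $\alpha^\perp$. -}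

module Defs where

open import Data.Nat using (ℕ; zero; suc; _+_)
open import Data.Nat.Properties using (_≟_)
open import Data.List using (List; []; _∷_; _++_; [_])
open import Data.List.NonEmpty using (List⁺; _∷_; foldr₁; toList)
open import Data.List.Relation.Binary.Permutation.Propositional using (_↭_)
open import Data.Product using (_×_)
open import Data.Sum using (_⊎_)
open import Relation.Nullary using (yes; no)
open import Relation.Binary.PropositionalEquality using (_≡_)

Atom : Set
Atom = ℕ

data Formula : Set where
  pos : Atom → Formula
  neg : Atom → Formula
  _⊗_ : Formula → Formula → Formula
  _⅋_ : Formula → Formula → Formula

infixr 7 _⊗_
infixr 6 _⅋_

_ᗮ : Formula → Formula
pos a ᗮ = neg a
neg a ᗮ = pos a
(A ⊗ B) ᗮ = (A ᗮ) ⅋ (B ᗮ)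
(A ⅋ B) ᗮ = (A ᗮ) ⊗ (B ᗮ)

infix 8 _ᗮ

_⊸_ : Formula → Formula → Formula
A ⊸ B = (A ᗮ) ⅋ B

infixr 5 _⊸_

Sequent : Set
Sequent = List Formula

infix 3 ⊢_
data ⊢_ : Sequent → Set where
  ax     : ∀ a → ⊢ neg a ∷ pos a ∷ []
  cut    : ∀ {Γ Δ} A → ⊢ Γ ++ [ A ] → ⊢ Δ ++ [ A ᗮ ] → ⊢ Γ ++ Δ
  exch   : ∀ {Γ Δ} → Γ ↭ Δ → ⊢ Γ → ⊢ Δ
  mix    : ∀ {Γ Δ} → ⊢ Γ → ⊢ Δ → ⊢ Γ ++ Δ
  tensor : ∀ {Γ Δ} A B → ⊢ Γ ++ [ A ] → ⊢ Δ ++ [ B ] → ⊢ Γ ++ Δ ++ [ A ⊗ B ]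
  par    : ∀ {Γ} A B → ⊢ Γ ++ A ∷ B ∷ [] → ⊢ Γ ++ [ A ⅋ B ]

data FCtx : Set where
  hole : FCtx
  _⊗ₗ_ : FCtx → Formula → FCtx
  _⊗ᵣ_ : Formula → FCtx → FCtx
  _⅋ₗ_ : FCtx → Formula → FCtx
  _⅋ᵣ_ : Formula → FCtx → FCtx

fplug : FCtx → Formula → Formula
fplug hole X = X
fplug (K ⊗ₗ B) X = fplug K X ⊗ B
fplug (A ⊗ᵣ K) X = A ⊗ fplug K X
fplug (K ⅋ₗ B) X = fplug K X ⅋ B
fplug (A ⅋ᵣ K) X = A ⅋ fplug K X

record SCtx : Set where
  constructor sctx
  field
    left  : Sequent
    inner : FCtx
    right : Sequent

plug : SCtx → Formula → List⁺ Formula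
plug (sctx [] K R) X = fplug K X ∷ R
plug (sctx (F ∷ L) K R) X = F ∷ (L ++ fplug K X ∷ R)

bigPar : List⁺ Formula → Formula
bigPar = foldr₁ _⅋_

_⊸ₛ_ : List⁺ Formula → List⁺ Formula → Formula
Γ ⊸ₛ Δ = bigPar Γ ⊸ bigPar Δ

countPos countNeg : Atom → Formula → ℕ
countPos a (pos b) with a ≟ b
... | yes _ = 1
... | no _  = 0
countPos a (neg b) = 0
countPos a (A ⊗ B) = countPos a A + countPos a B
countPos a (A ⅋ B) = countPos a A + countPos a B
countNeg a (pos b) = 0
countNeg a (neg b) with a ≟ b
... | yes _ = 1
... | no _  = 0
countNeg a (A ⊗ B) = countNeg a A + countNeg a B
countNeg a (A ⅋ B) = countNeg a A + countNeg a B

countPosS countNegS : Atom → Sequent → ℕ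
countPosS a [] = 0
countPosS a (F ∷ Γ) = countPos a F + countPosS a Γ
countNegS a [] = 0
countNegS a (F ∷ Γ) = countNeg a F + countNegS a Γ

Binary : Sequent → Set
Binary Γ = ∀ a → (countPosS a Γ ≡ 0 × countNegS a Γ ≡ 0)
               ⊎ (countPosS a Γ ≡ 1 × countNegS a Γ ≡ 1)

-- A ⊗ (B ⊗ C) entails A ⊗ (B ⅋ C) and A ⅋ (B ⊗ C), since F ⊗ G entails F ⅋ G by
-- mix; entailment lifts through any context, and cut transports provability along
-- it. This gives (1) and the forward half of (2).
--
-- Conversely, take cut-free proofs and follow A ⊗ (B ⅋ C) in the proof of
-- D[A ⊗ (B ⅋ C)] up to its tensor rule, with premises Γ₁, A and Γ₂, B ⅋ C. A
-- provable sequent contains each of its atoms with both polarities, so in a binary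
-- sequent the two premises share no atom. Erasing from the proof of
-- Γ₁, Γ₂, A ⅋ (B ⊗ C) all atoms of the first premise therefore proves Γ₂, B ⊗ C,
-- and a tensor with Γ₁, A yields Γ₁, Γ₂, A ⊗ (B ⊗ C). The rules below that tensor
-- are replayed one by one, each time erasing from the proof of D[A ⅋ (B ⊗ C)] the
-- atoms of the premise not containing the hole.
module Submission where

open import Defs
open import Data.Bool using (Bool; true; false)
open import Data.Empty using (⊥-elim)
open import Data.List using (List; []; _∷_; _++_; [_]; map; mapMaybe; catMaybes)
open import Data.List.NonEmpty using (_∷_; toList)
open import Data.List.Properties using (map-++; mapMaybe-++; ++-identityʳ)
open import Data.List.Membership.Propositional using (_∈_)
open import Data.List.Membership.Propositional.Properties using (∈-++⁻; ∈-∃++)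
open import Data.List.Relation.Unary.Any using (Any; here; there)
open import Data.List.Relation.Unary.Any.Properties using (++⁺ˡ; ++⁺ʳ)
open import Data.List.Relation.Binary.Permutation.Propositional
  using (_↭_; ↭-refl; ↭-sym; ↭-trans; ↭-prep; ↭-swap; ↭-reflexive)
open import Data.List.Relation.Binary.Permutation.Propositional.Properties
  using (++-commutativeMonoid; ∈-resp-↭; ↭-singleton-inv; ↭-empty-inv; drop-∷; shift; ∷↭∷ʳ; ++-comm; mapMaybe-↭; map⁺)
  renaming (++⁺ˡ to ↭-++⁺ˡ; ++⁺ʳ to ↭-++⁺ʳ)
open import Data.Maybe using (Maybe; just; nothing)
open import Data.Nat using (ℕ; suc; _+_; _≤_; _<_; z≤n; s≤s; _≡ᵇ_)
open import Data.Nat.ListAction using (sum)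
open import Data.Nat.ListAction.Properties using (sum-++; sum-↭)
open import Data.Nat.Properties using (_≟_; +-assoc; +-identityʳ; <-≤-trans; ≤-refl; ≤-trans; m≤m+n; m≤n+m; n≤0⇒n≡0; m+n≡0⇒n≡0)
open import Data.Product using (∃; _×_; _,_)
open import Data.Sum using (_⊎_; inj₁; inj₂)
open import Function.Bundles using (_⇔_; mk⇔)
open import Relation.Nullary using (¬_; yes; no)
open import Relation.Binary.PropositionalEquality using (_≡_; refl; sym; trans; cong; cong₂; subst; module ≡-Reasoning)
open import Function.Base using (_∘_)

open import Algebra.Solver.CommutativeMonoid (++-commutativeMonoid {A = Formula})
  using (solve; _⊜_; _⊕_; id)

private
  variable
    a b : Atom
    A F G H X Y : Formula
    Γ Γ′ Γ₁ Γ₂ Δ Δ₁ Δ₂ Λ Σ : Sequent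

infix 3 ⊢cf_
data ⊢cf_ : Sequent → Set where
  ax     : ∀ a → ⊢cf neg a ∷ pos a ∷ []
  exch   : Γ ↭ Δ → ⊢cf Γ → ⊢cf Δ
  mix    : ⊢cf Γ → ⊢cf Δ → ⊢cf Γ ++ Δ
  tensor : ∀ F G → ⊢cf Γ ++ [ F ] → ⊢cf Δ ++ [ G ] → ⊢cf Γ ++ Δ ++ [ F ⊗ G ]
  par    : ∀ F G → ⊢cf Γ ++ F ∷ G ∷ [] → ⊢cf Γ ++ [ F ⅋ G ]

⊢cf⇒⊢ : ⊢cf Γ → ⊢ Γ
⊢cf⇒⊢ (ax a)           = ax a
⊢cf⇒⊢ (exch p d)       = exch p (⊢cf⇒⊢ d)
⊢cf⇒⊢ (mix d e)        = mix (⊢cf⇒⊢ d) (⊢cf⇒⊢ e)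
⊢cf⇒⊢ (tensor F G d e) = tensor F G (⊢cf⇒⊢ d) (⊢cf⇒⊢ e)
⊢cf⇒⊢ (par F G d)      = par F G (⊢cf⇒⊢ d)

↭-rotate : ∀ (Γ : Sequent) F → Γ ++ [ F ] ↭ F ∷ Γ
↭-rotate Γ F = ↭-sym (∷↭∷ʳ F Γ)

↭-rotate₂ : ∀ Γ₁ Γ₂ F → Γ₁ ++ Γ₂ ++ [ F ] ↭ F ∷ Γ₁ ++ Γ₂
↭-rotate₂ Γ₁ Γ₂ F = solve 3 (λ x y f → x ⊕ y ⊕ f ⊜ f ⊕ x ⊕ y) ↭-refl Γ₁ Γ₂ [ F ]

data IsLiteral : Formula → Set where
  pos-literal : ∀ a → IsLiteral (pos a)
  neg-literal : ∀ a → IsLiteral (neg a)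

↭-axiom-inv : neg b ∷ pos b ∷ [] ↭ A ∷ Γ → IsLiteral A × Γ ≡ [ A ᗮ ]
↭-axiom-inv {b} p = locate (∈-resp-↭ (↭-sym p) (here refl)) p
  where
  locate : A ∈ neg b ∷ pos b ∷ [] → neg b ∷ pos b ∷ [] ↭ A ∷ Γ → IsLiteral A × Γ ≡ [ A ᗮ ]
  locate (here refl) p = neg-literal b , ↭-singleton-inv (↭-sym (drop-∷ p))
  locate (there (here refl)) p = pos-literal b , ↭-singleton-inv (↭-sym (drop-∷ (↭-trans (↭-swap _ _ ↭-refl) p)))

↭-singleton-∷-inv : [ F ] ↭ A ∷ Γ → A ≡ F × Γ ≡ []
↭-singleton-∷-inv p with ↭-singleton-inv (↭-sym p)
... | refl = refl , refl

↭-++-∷-inv : ∀ Γ₁ Γ₂ → Γ₁ ++ Γ₂ ↭ A ∷ Γ →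
  (∃ λ Γ′ → Γ₁ ↭ A ∷ Γ′ × Γ ↭ Γ′ ++ Γ₂) ⊎ (∃ λ Γ′ → Γ₂ ↭ A ∷ Γ′ × Γ ↭ Γ₁ ++ Γ′)
↭-++-∷-inv {A} Γ₁ Γ₂ p with ∈-++⁻ Γ₁ (∈-resp-↭ (↭-sym p) (here refl))
... | inj₁ A∈Γ₁ with ∈-∃++ A∈Γ₁
...   | P , Q , refl = inj₁ (P ++ Q , shift A P Q , drop-∷ (↭-trans (↭-sym p) (↭-++⁺ʳ Γ₂ (shift A P Q))))
↭-++-∷-inv {A} Γ₁ Γ₂ p | inj₂ A∈Γ₂ with ∈-∃++ A∈Γ₂
...   | P , Q , refl = inj₂ (P ++ Q , shift A P Q ,
          drop-∷ (↭-trans (↭-sym p) (↭-trans (↭-++⁺ˡ Γ₁ (shift A P Q)) (shift A Γ₁ (P ++ Q)))))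

-- The cases of an induction on a cut-free proof of A ∷ Γ that follows the
-- formula A up to the rule introducing it.
record Analysis (A : Formula) (T : Sequent → Set) : Set where
  field
    T-resp-↭     : Γ ↭ Γ′ → T Γ → T Γ′
    mix-left     : T Γ₁ → ⊢cf Γ₂ → T (Γ₁ ++ Γ₂)
    mix-right    : ⊢cf Γ₁ → T Γ₂ → T (Γ₁ ++ Γ₂)
    tensor-left  : ∀ F G → T (Γ₁ ++ [ F ]) → ⊢cf Γ₂ ++ [ G ] → T (Γ₁ ++ Γ₂ ++ [ F ⊗ G ])
    tensor-right : ∀ F G → ⊢cf Γ₁ ++ [ F ] → T (Γ₂ ++ [ G ]) → T (Γ₁ ++ Γ₂ ++ [ F ⊗ G ])
    par-side     : ∀ F G → T (Γ ++ F ∷ G ∷ []) → T (Γ ++ [ F ⅋ G ])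
    axiom        : IsLiteral A → T [ A ᗮ ]
    tensor-main  : ∀ F G → A ≡ F ⊗ G → ⊢cf Γ₁ ++ [ F ] → ⊢cf Γ₂ ++ [ G ] → T (Γ₁ ++ Γ₂)
    par-main     : ∀ F G → A ≡ F ⅋ G → ⊢cf Γ ++ F ∷ G ∷ [] → T Γ

module _ {T : Sequent → Set} (𝒜 : Analysis A T) where
  open Analysis 𝒜

  analyse : ⊢cf Σ → Σ ↭ A ∷ Γ → T Γ
  analyse (ax b) p with ↭-axiom-inv p
  ... | lit , refl = axiom lit
  analyse (exch q d) p = analyse d (↭-trans q p)
  analyse (mix {Γ₁} {Γ₂} d₁ d₂) p with ↭-++-∷-inv Γ₁ Γ₂ p
  ... | inj₁ (_ , p₁ , q) = T-resp-↭ (↭-sym q) (mix-left (analyse d₁ p₁) d₂)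
  ... | inj₂ (_ , p₂ , q) = T-resp-↭ (↭-sym q) (mix-right d₁ (analyse d₂ p₂))
  analyse (tensor {Γ₁} {Γ₂} F G d₁ d₂) p with ↭-++-∷-inv Γ₁ (Γ₂ ++ [ F ⊗ G ]) p
  ... | inj₁ (_ , p₁ , q) = T-resp-↭ (↭-sym q) (tensor-left F G (analyse d₁ (↭-++⁺ʳ [ F ] p₁)) d₂)
  ... | inj₂ (_ , p₂ , q) with ↭-++-∷-inv Γ₂ [ F ⊗ G ] p₂
  ...   | inj₁ (_ , p₃ , q′) =
          T-resp-↭ (↭-sym (↭-trans q (↭-++⁺ˡ Γ₁ q′))) (tensor-right F G d₁ (analyse d₂ (↭-++⁺ʳ [ G ] p₃)))
  ...   | inj₂ (_ , p₃ , q′) with ↭-singleton-∷-inv p₃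
  ...     | eq , refl =
          T-resp-↭ (↭-sym (↭-trans q (↭-++⁺ˡ Γ₁ (↭-trans q′ (↭-reflexive (++-identityʳ Γ₂))))))
            (tensor-main F G eq d₁ d₂)
  analyse (par {Γ₀} F G d) p with ↭-++-∷-inv Γ₀ [ F ⅋ G ] p
  ... | inj₁ (_ , p₁ , q) = T-resp-↭ (↭-sym q) (par-side F G (analyse d (↭-++⁺ʳ (F ∷ G ∷ []) p₁)))
  ... | inj₂ (_ , p₂ , q) with ↭-singleton-∷-inv p₂
  ...   | eq , refl = T-resp-↭ (↭-sym (↭-trans q (↭-reflexive (++-identityʳ Γ₀)))) (par-main F G eq d)

-- Only the rules introducing A need an argument; the others commute with
-- appending Δ.
appending : ∀ Δ →
  (IsLiteral A → ⊢cf A ᗮ ∷ Δ) →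
  (∀ {Γ₁ Γ₂} F G → A ≡ F ⊗ G → ⊢cf Γ₁ ++ [ F ] → ⊢cf Γ₂ ++ [ G ] → ⊢cf (Γ₁ ++ Γ₂) ++ Δ) →
  (∀ {Γ} F G → A ≡ F ⅋ G → ⊢cf Γ ++ F ∷ G ∷ [] → ⊢cf Γ ++ Δ) →
  Analysis A (λ Γ → ⊢cf Γ ++ Δ)
appending Δ axiom tensor-main par-main = record
  { T-resp-↭     = λ p → exch (↭-++⁺ʳ Δ p)
  ; mix-left     = λ {Γ₁} {Γ₂} d e →
      exch (solve 3 (λ x y z → (x ⊕ z) ⊕ y ⊜ (x ⊕ y) ⊕ z) ↭-refl Γ₁ Γ₂ Δ) (mix d e)
  ; mix-right    = λ {Γ₁} {Γ₂} d e →
      exch (solve 3 (λ x y z → x ⊕ (y ⊕ z) ⊜ (x ⊕ y) ⊕ z) ↭-refl Γ₁ Γ₂ Δ) (mix d e)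
  ; tensor-left  = λ {Γ₁} {Γ₂} F G d e →
      exch (solve 4 (λ x y z w → (x ⊕ z) ⊕ y ⊕ w ⊜ (x ⊕ y ⊕ w) ⊕ z) ↭-refl Γ₁ Γ₂ Δ [ F ⊗ G ])
        (tensor {Γ₁ ++ Δ} F G
          (exch (solve 3 (λ x f z → (x ⊕ f) ⊕ z ⊜ (x ⊕ z) ⊕ f) ↭-refl Γ₁ [ F ] Δ) d) e)
  ; tensor-right = λ {Γ₁} {Γ₂} F G d e →
      exch (solve 4 (λ x y z w → x ⊕ (y ⊕ z) ⊕ w ⊜ (x ⊕ y ⊕ w) ⊕ z) ↭-refl Γ₁ Γ₂ Δ [ F ⊗ G ])
        (tensor {Δ = Γ₂ ++ Δ} F G d
          (exch (solve 3 (λ y g z → (y ⊕ g) ⊕ z ⊜ (y ⊕ z) ⊕ g) ↭-refl Γ₂ [ G ] Δ) e))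
  ; par-side     = λ {Γ} F G d →
      exch (solve 3 (λ x z w → (x ⊕ z) ⊕ w ⊜ (x ⊕ w) ⊕ z) ↭-refl Γ Δ [ F ⅋ G ])
        (par {Γ ++ Δ} F G
          (exch (solve 3 (λ x fg z → (x ⊕ fg) ⊕ z ⊜ (x ⊕ z) ⊕ fg) ↭-refl Γ (F ∷ G ∷ []) Δ) d))
  ; axiom        = axiom
  ; tensor-main  = tensor-main
  ; par-main     = par-main
  }

⅋-inv : ⊢cf Σ → Σ ↭ F ⅋ G ∷ Γ → ⊢cf F ∷ G ∷ Γ
⅋-inv {F = F} {G} {Γ} d p =
  exch (solve 2 (λ x fg → x ⊕ fg ⊜ fg ⊕ x) ↭-refl Γ (F ∷ G ∷ []))
    (analyse (appending (F ∷ G ∷ []) (λ ()) (λ _ _ ()) λ { _ _ refl d′ → d′ }) d p)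

cut-admissible : ∀ A {Γ Δ} → ⊢cf A ∷ Γ → ⊢cf A ᗮ ∷ Δ → ⊢cf Γ ++ Δ
cut-admissible (pos a) {Δ = Δ} d e = analyse (appending Δ (λ _ → e) (λ _ _ ()) (λ _ _ ())) d ↭-refl
cut-admissible (neg a) {Δ = Δ} d e = analyse (appending Δ (λ _ → e) (λ _ _ ()) (λ _ _ ())) d ↭-refl
cut-admissible (F ⊗ G) {Δ = Δ} d e = analyse (appending Δ (λ ()) principal (λ _ _ ())) d ↭-refl
  where
  principal : ∀ {Γ₁ Γ₂} F′ G′ → F ⊗ G ≡ F′ ⊗ G′ → ⊢cf Γ₁ ++ [ F′ ] → ⊢cf Γ₂ ++ [ G′ ] → ⊢cf (Γ₁ ++ Γ₂) ++ Δ
  principal {Γ₁} {Γ₂} _ _ refl d₁ d₂ =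
    exch (solve 3 (λ x y z → y ⊕ x ⊕ z ⊜ (x ⊕ y) ⊕ z) ↭-refl Γ₁ Γ₂ Δ)
      (cut-admissible G (exch (↭-rotate Γ₂ G) d₂)
        (exch (shift (G ᗮ) Γ₁ Δ)
          (cut-admissible F (exch (↭-rotate Γ₁ F) d₁) (⅋-inv e ↭-refl))))
cut-admissible (F ⅋ G) {Γ} {Δ} d e =
  exch (++-comm Δ Γ) (analyse (appending Γ (λ ()) principal (λ _ _ ())) e ↭-refl)
  where
  principal : ∀ {Δ₁ Δ₂} F′ G′ → F ᗮ ⊗ G ᗮ ≡ F′ ⊗ G′ → ⊢cf Δ₁ ++ [ F′ ] → ⊢cf Δ₂ ++ [ G′ ] → ⊢cf (Δ₁ ++ Δ₂) ++ Γ
  principal {Δ₁} {Δ₂} _ _ refl e₁ e₂ =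
    exch (solve 3 (λ x y z → (x ⊕ y) ⊕ z ⊜ (y ⊕ z) ⊕ x) ↭-refl Γ Δ₁ Δ₂)
      (cut-admissible G (cut-admissible F (⅋-inv d ↭-refl) (exch (↭-rotate Δ₁ (F ᗮ)) e₁))
        (exch (↭-rotate Δ₂ (G ᗮ)) e₂))

cut-elimination : ⊢ Γ → ⊢cf Γ
cut-elimination (ax a)           = ax a
cut-elimination (cut {Γ} {Δ} A d e) =
  cut-admissible A (exch (↭-rotate Γ A) (cut-elimination d)) (exch (↭-rotate Δ (A ᗮ)) (cut-elimination e))
cut-elimination (exch p d)       = exch p (cut-elimination d)
cut-elimination (mix d e)        = mix (cut-elimination d) (cut-elimination e)
cut-elimination (tensor A B d e) = tensor A B (cut-elimination d) (cut-elimination e)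
cut-elimination (par A B d)      = par A B (cut-elimination d)

infix 4 _⊩_
_⊩_ : Formula → Formula → Set
X ⊩ Y = ⊢cf X ᗮ ∷ Y ∷ []

⊢cf-swap : ⊢cf X ∷ Y ∷ [] → ⊢cf Y ∷ X ∷ []
⊢cf-swap = exch (↭-swap _ _ ↭-refl)

⊗-⊩ : ∀ {F F′ G G′} → F ⊩ F′ → G ⊩ G′ → F ⊗ G ⊩ F′ ⊗ G′
⊗-⊩ {F} {F′} {G} {G′} d e =
  ⊢cf-swap (par {[ F′ ⊗ G′ ]} (F ᗮ) (G ᗮ)
    (exch (solve 3 (λ x y z → x ⊕ y ⊕ z ⊜ z ⊕ x ⊕ y) ↭-refl [ F ᗮ ] [ G ᗮ ] [ F′ ⊗ G′ ])
      (tensor {[ F ᗮ ]} {[ G ᗮ ]} F′ G′ d e)))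

⅋-⊩ : ∀ {F F′ G G′} → F ⊩ F′ → G ⊩ G′ → F ⅋ G ⊩ F′ ⅋ G′
⅋-⊩ {F} {F′} {G} {G′} d e =
  par {[ F ᗮ ⊗ G ᗮ ]} F′ G′
    (exch (solve 3 (λ x y z → x ⊕ y ⊕ z ⊜ z ⊕ x ⊕ y) ↭-refl [ F′ ] [ G′ ] [ F ᗮ ⊗ G ᗮ ])
      (tensor {[ F′ ]} {[ G′ ]} (F ᗮ) (G ᗮ) (⊢cf-swap d) (⊢cf-swap e)))

⊩-refl : ∀ F → F ⊩ F
⊩-refl (pos a) = ax a
⊩-refl (neg a) = ⊢cf-swap (ax a)
⊩-refl (F ⊗ G) = ⊗-⊩ (⊩-refl F) (⊩-refl G)
⊩-refl (F ⅋ G) = ⅋-⊩ (⊩-refl F) (⊩-refl G)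

⊗-⊩-⅋ : ∀ F G → F ⊗ G ⊩ F ⅋ G
⊗-⊩-⅋ F G =
  par {[ F ᗮ ⅋ G ᗮ ]} F G
    (exch (solve 3 (λ x y z → x ⊕ y ⊕ z ⊜ z ⊕ x ⊕ y) ↭-refl [ F ] [ G ] [ F ᗮ ⅋ G ᗮ ])
      (par {F ∷ G ∷ []} (F ᗮ) (G ᗮ)
        (exch (solve 4 (λ x y z w → x ⊕ y ⊕ z ⊕ w ⊜ y ⊕ w ⊕ x ⊕ z) ↭-refl [ F ᗮ ] [ F ] [ G ᗮ ] [ G ])
          (mix (⊩-refl F) (⊩-refl G)))))

fplug-⊩ : ∀ K → X ⊩ Y → fplug K X ⊩ fplug K Y
fplug-⊩ hole     d = d
fplug-⊩ (K ⊗ₗ B) d = ⊗-⊩ (fplug-⊩ K d) (⊩-refl B)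
fplug-⊩ (B ⊗ᵣ K) d = ⊗-⊩ (⊩-refl B) (fplug-⊩ K d)
fplug-⊩ (K ⅋ₗ B) d = ⅋-⊩ (fplug-⊩ K d) (⊩-refl B)
fplug-⊩ (B ⅋ᵣ K) d = ⅋-⊩ (⊩-refl B) (fplug-⊩ K d)

toList-plug : ∀ D X → toList (plug D X) ≡ SCtx.left D ++ fplug (SCtx.inner D) X ∷ SCtx.right D
toList-plug (sctx [] K R)      X = refl
toList-plug (sctx (F ∷ L) K R) X = refl

parContext : SCtx → FCtx
parContext (sctx [] K [])       = K
parContext (sctx [] K (G ∷ R))  = K ⅋ₗ bigPar (G ∷ R)
parContext (sctx (F ∷ L) K R)   = F ⅋ᵣ parContext (sctx L K R)

bigPar-plug : ∀ D X → bigPar (plug D X) ≡ fplug (parContext D) X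
bigPar-plug (sctx [] K [])          X = refl
bigPar-plug (sctx [] K (G ∷ R))     X = refl
bigPar-plug (sctx (F ∷ []) K R)     X = cong (F ⅋_) (bigPar-plug (sctx [] K R) X)
bigPar-plug (sctx (F ∷ G ∷ L) K R)  X = cong (F ⅋_) (bigPar-plug (sctx (G ∷ L) K R) X)

⊸ₛ-plug-mono : ∀ D → X ⊩ Y → ⊢ [ plug D X ⊸ₛ plug D Y ]
⊸ₛ-plug-mono {X} {Y} D d rewrite bigPar-plug D X | bigPar-plug D Y =
  ⊢cf⇒⊢ (par {[]} _ _ (fplug-⊩ (parContext D) d))

⊢-plug-mono : ∀ D → X ⊩ Y → ⊢ toList (plug D X) → ⊢ toList (plug D Y)
⊢-plug-mono {X} {Y} D@(sctx L K R) d p rewrite toList-plug D X | toList-plug D Y =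
  exch (solve 3 (λ l r y → (l ⊕ r) ⊕ y ⊜ l ⊕ y ⊕ r) ↭-refl L R [ fplug K Y ])
    (cut {L ++ R} (fplug K X)
      (exch (solve 3 (λ l x r → l ⊕ x ⊕ r ⊜ (l ⊕ r) ⊕ x) ↭-refl L [ fplug K X ] R) p)
      (⊢cf⇒⊢ (⊢cf-swap (fplug-⊩ K d))))

data Polarity : Set where
  positive negative : Polarity

count : Polarity → Atom → Formula → ℕ
count positive = countPos
count negative = countNeg

count-⊗ : ∀ p → count p a (F ⊗ G) ≡ count p a F + count p a G
count-⊗ positive = refl
count-⊗ negative = refl

count-⅋ : ∀ p → count p a (F ⅋ G) ≡ count p a F + count p a G
count-⅋ positive = refl
count-⅋ negative = refl

countS : Polarity → Atom → Sequent → ℕ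
countS p a Γ = sum (map (count p a) Γ)

countS-++ : ∀ p a Γ Δ → countS p a (Γ ++ Δ) ≡ countS p a Γ + countS p a Δ
countS-++ p a Γ Δ = trans (cong sum (map-++ (count p a) Γ Δ)) (sum-++ (map (count p a) Γ) (map (count p a) Δ))

countPosS≡countS : ∀ a Γ → countPosS a Γ ≡ countS positive a Γ
countPosS≡countS a []      = refl
countPosS≡countS a (F ∷ Γ) = cong (countPos a F +_) (countPosS≡countS a Γ)

countNegS≡countS : ∀ a Γ → countNegS a Γ ≡ countS negative a Γ
countNegS≡countS a []      = refl
countNegS≡countS a (F ∷ Γ) = cong (countNeg a F +_) (countNegS≡countS a Γ)

infix 4 _≈ᵃ_
record _≈ᵃ_ (Γ Δ : Sequent) : Set where
  constructor mk≈ᵃ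
  field count-≡ : ∀ p a → countS p a Γ ≡ countS p a Δ
open _≈ᵃ_

≈ᵃ-sym : Γ ≈ᵃ Δ → Δ ≈ᵃ Γ
≈ᵃ-sym eq = mk≈ᵃ λ p a → sym (count-≡ eq p a)

≈ᵃ-trans : Γ ≈ᵃ Δ → Δ ≈ᵃ Λ → Γ ≈ᵃ Λ
≈ᵃ-trans eq eq′ = mk≈ᵃ λ p a → trans (count-≡ eq p a) (count-≡ eq′ p a)

↭⇒≈ᵃ : Γ ↭ Δ → Γ ≈ᵃ Δ
↭⇒≈ᵃ q = mk≈ᵃ λ p a → sum-↭ (map⁺ (count p a) q)

⊗-≈ᵃ : F ⊗ G ∷ Γ ≈ᵃ F ∷ G ∷ Γ
⊗-≈ᵃ {F} {G} = mk≈ᵃ λ p a → trans (cong (_+ _) (count-⊗ p)) (+-assoc (count p a F) (count p a G) _)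

⅋-≈ᵃ : F ⅋ G ∷ Γ ≈ᵃ F ∷ G ∷ Γ
⅋-≈ᵃ {F} {G} = mk≈ᵃ λ p a → trans (cong (_+ _) (count-⅋ p)) (+-assoc (count p a F) (count p a G) _)

≈ᵃ-⊗ : Γ ↭ F ⊗ G ∷ Δ → F ∷ G ∷ Δ ↭ Γ′ → Γ ≈ᵃ Γ′
≈ᵃ-⊗ q q′ = ≈ᵃ-trans (↭⇒≈ᵃ q) (≈ᵃ-trans ⊗-≈ᵃ (↭⇒≈ᵃ q′))

≈ᵃ-⅋ : Γ ↭ F ⅋ G ∷ Δ → F ∷ G ∷ Δ ↭ Γ′ → Γ ≈ᵃ Γ′
≈ᵃ-⅋ q q′ = ≈ᵃ-trans (↭⇒≈ᵃ q) (≈ᵃ-trans ⅋-≈ᵃ (↭⇒≈ᵃ q′))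

fplug-≈ᵃ : ∀ K → [ X ] ≈ᵃ [ Y ] → fplug K X ∷ Γ ≈ᵃ fplug K Y ∷ Γ
fplug-≈ᵃ {X} {Y} {Γ} K eq = mk≈ᵃ λ p a → cong (_+ countS p a Γ) (count-fplug p a K)
  where
  count-fplug : ∀ p a K → count p a (fplug K X) ≡ count p a (fplug K Y)
  count-fplug p a hole     = trans (sym (+-identityʳ _)) (trans (count-≡ eq p a) (+-identityʳ _))
  count-fplug p a (K ⊗ₗ B) = trans (count-⊗ p) (trans (cong (_+ _) (count-fplug p a K)) (sym (count-⊗ p)))
  count-fplug p a (B ⊗ᵣ K) = trans (count-⊗ p) (trans (cong (_ +_) (count-fplug p a K)) (sym (count-⊗ p)))
  count-fplug p a (K ⅋ₗ B) = trans (count-⅋ p) (trans (cong (_+ _) (count-fplug p a K)) (sym (count-⅋ p)))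
  count-fplug p a (B ⅋ᵣ K) = trans (count-⅋ p) (trans (cong (_ +_) (count-fplug p a K)) (sym (count-⅋ p)))

record Balanced (Γ : Sequent) : Set where
  constructor mkBalanced
  field balance : ∀ a → countS positive a Γ ≡ countS negative a Γ
open Balanced

Balanced-resp-≈ᵃ : Γ ≈ᵃ Δ → Balanced Γ → Balanced Δ
Balanced-resp-≈ᵃ eq bal =
  mkBalanced λ a → trans (sym (count-≡ eq positive a)) (trans (balance bal a) (count-≡ eq negative a))

Balanced-++ : Balanced Γ → Balanced Δ → Balanced (Γ ++ Δ)
Balanced-++ {Γ} {Δ} bal bal′ = mkBalanced λ a →
  trans (countS-++ positive a Γ Δ)
    (trans (cong₂ _+_ (balance bal a) (balance bal′ a)) (sym (countS-++ negative a Γ Δ)))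

balanced : ⊢cf Γ → Balanced Γ
balanced (ax b) = mkBalanced balance-ax
  where
  balance-ax : ∀ a → countS positive a (neg b ∷ pos b ∷ []) ≡ countS negative a (neg b ∷ pos b ∷ [])
  balance-ax a with a ≟ b
  ... | yes _ = refl
  ... | no _  = refl
balanced (exch q d) = Balanced-resp-≈ᵃ (↭⇒≈ᵃ q) (balanced d)
balanced (mix d e)  = Balanced-++ (balanced d) (balanced e)
balanced (tensor {Γ₁} {Γ₂} F G d e) =
  Balanced-resp-≈ᵃ
    (≈ᵃ-sym (≈ᵃ-⊗ (↭-rotate₂ Γ₁ Γ₂ (F ⊗ G))
      (solve 4 (λ f g x y → f ⊕ g ⊕ x ⊕ y ⊜ (x ⊕ f) ⊕ y ⊕ g) ↭-refl [ F ] [ G ] Γ₁ Γ₂)))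
    (Balanced-++ (balanced d) (balanced e))
balanced (par {Γ} F G d) =
  Balanced-resp-≈ᵃ
    (≈ᵃ-sym (≈ᵃ-⅋ (↭-rotate Γ (F ⅋ G)) (solve 2 (λ fg x → fg ⊕ x ⊜ x ⊕ fg) ↭-refl (F ∷ G ∷ []) Γ)))
    (balanced d)

record Linear (Γ : Sequent) : Set where
  constructor mkLinear
  field at-most-once : ∀ p a → countS p a Γ ≤ 1
open Linear

Linear-resp-≈ᵃ : Γ ≈ᵃ Δ → Linear Γ → Linear Δ
Linear-resp-≈ᵃ eq lin = mkLinear λ p a → subst (_≤ 1) (count-≡ eq p a) (at-most-once lin p a)

Linear-resp-↭ : Γ ↭ Δ → Linear Γ → Linear Δ
Linear-resp-↭ q = Linear-resp-≈ᵃ (↭⇒≈ᵃ q)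

Linear-++⁻ˡ : ∀ Γ → Linear (Γ ++ Δ) → Linear Γ
Linear-++⁻ˡ {Δ} Γ lin =
  mkLinear λ p a → ≤-trans (m≤m+n _ _) (subst (_≤ 1) (countS-++ p a Γ Δ) (at-most-once lin p a))

Binary⇒Linear : Binary Γ → Linear Γ
Binary⇒Linear {Γ} bin = mkLinear at-most-once′
  where
  at-most-once′ : ∀ p a → countS p a Γ ≤ 1
  at-most-once′ positive a rewrite sym (countPosS≡countS a Γ) with bin a
  ... | inj₁ (eq , _) rewrite eq = z≤n
  ... | inj₂ (eq , _) rewrite eq = ≤-refl
  at-most-once′ negative a rewrite sym (countNegS≡countS a Γ) with bin a
  ... | inj₁ (_ , eq) rewrite eq = z≤n
  ... | inj₂ (_ , eq) rewrite eq = ≤-refl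

data Occ (a : Atom) : Polarity → Formula → Set where
  at-pos : Occ a positive (pos a)
  at-neg : Occ a negative (neg a)
  in-⊗ˡ  : ∀ {p F G} → Occ a p F → Occ a p (F ⊗ G)
  in-⊗ʳ  : ∀ {p F G} → Occ a p G → Occ a p (F ⊗ G)
  in-⅋ˡ  : ∀ {p F G} → Occ a p F → Occ a p (F ⅋ G)
  in-⅋ʳ  : ∀ {p F G} → Occ a p G → Occ a p (F ⅋ G)

OccS : Atom → Polarity → Sequent → Set
OccS a p = Any (Occ a p)

fplug-Occ : ∀ K {a p} → (Occ a p X → Occ a p Y) → Occ a p (fplug K X) → Occ a p (fplug K Y)
fplug-Occ hole     f o         = f o
fplug-Occ (K ⊗ₗ B) f (in-⊗ˡ o) = in-⊗ˡ (fplug-Occ K f o)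
fplug-Occ (K ⊗ₗ B) f (in-⊗ʳ o) = in-⊗ʳ o
fplug-Occ (B ⊗ᵣ K) f (in-⊗ˡ o) = in-⊗ˡ o
fplug-Occ (B ⊗ᵣ K) f (in-⊗ʳ o) = in-⊗ʳ (fplug-Occ K f o)
fplug-Occ (K ⅋ₗ B) f (in-⅋ˡ o) = in-⅋ˡ (fplug-Occ K f o)
fplug-Occ (K ⅋ₗ B) f (in-⅋ʳ o) = in-⅋ʳ o
fplug-Occ (B ⅋ᵣ K) f (in-⅋ˡ o) = in-⅋ˡ o
fplug-Occ (B ⅋ᵣ K) f (in-⅋ʳ o) = in-⅋ʳ (fplug-Occ K f o)

Occ⇒count : ∀ {p} → Occ a p F → 0 < count p a F
Occ⇒count {a} at-pos with a ≟ a
... | yes _ = s≤s z≤n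
... | no a≢a = ⊥-elim (a≢a refl)
Occ⇒count {a} at-neg with a ≟ a
... | yes _ = s≤s z≤n
... | no a≢a = ⊥-elim (a≢a refl)
Occ⇒count {p = p} (in-⊗ˡ o) = subst (0 <_) (sym (count-⊗ p)) (<-≤-trans (Occ⇒count o) (m≤m+n _ _))
Occ⇒count {p = p} (in-⊗ʳ o) = subst (0 <_) (sym (count-⊗ p)) (<-≤-trans (Occ⇒count o) (m≤n+m _ _))
Occ⇒count {p = p} (in-⅋ˡ o) = subst (0 <_) (sym (count-⅋ p)) (<-≤-trans (Occ⇒count o) (m≤m+n _ _))
Occ⇒count {p = p} (in-⅋ʳ o) = subst (0 <_) (sym (count-⅋ p)) (<-≤-trans (Occ⇒count o) (m≤n+m _ _))

OccS⇒countS : ∀ {p} → OccS a p Γ → 0 < countS p a Γ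
OccS⇒countS (here o)  = <-≤-trans (Occ⇒count o) (m≤m+n _ _)
OccS⇒countS (there o) = <-≤-trans (OccS⇒countS o) (m≤n+m _ _)

-- Erasing atoms may erase a whole sequent, so provability is taken up to the
-- empty sequent.
infix 3 ⊢cf⁰_
⊢cf⁰_ : Sequent → Set
⊢cf⁰ Γ = Γ ≡ [] ⊎ ⊢cf Γ

exch⁰ : Γ ↭ Δ → ⊢cf⁰ Γ → ⊢cf⁰ Δ
exch⁰ q (inj₁ refl) = inj₁ (↭-empty-inv (↭-sym q))
exch⁰ q (inj₂ d)    = inj₂ (exch q d)

mix⁰ : ⊢cf⁰ Γ → ⊢cf⁰ Δ → ⊢cf⁰ Γ ++ Δ
mix⁰ (inj₁ refl) o           = o
mix⁰ {Γ} (inj₂ d) (inj₁ refl) = inj₂ (exch (↭-reflexive (sym (++-identityʳ Γ))) d)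
mix⁰ (inj₂ d) (inj₂ e)       = inj₂ (mix d e)

⊢cf⁰-nonempty : ∀ Γ → ⊢cf⁰ Γ ++ F ∷ Δ → ⊢cf Γ ++ F ∷ Δ
⊢cf⁰-nonempty []      (inj₁ ())
⊢cf⁰-nonempty (_ ∷ _) (inj₁ ())
⊢cf⁰-nonempty _       (inj₂ d) = d

joinWith : (Formula → Formula → Formula) → Maybe Formula → Maybe Formula → Maybe Formula
joinWith _∙_ (just F) (just G) = just (F ∙ G)
joinWith _∙_ (just F) nothing  = just F
joinWith _∙_ nothing  mG       = mG

tensor⁰ : ∀ mF mG → ⊢cf⁰ Γ₁ ++ catMaybes [ mF ] → ⊢cf⁰ Γ₂ ++ catMaybes [ mG ] →
  ⊢cf⁰ Γ₁ ++ Γ₂ ++ catMaybes [ joinWith _⊗_ mF mG ]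
tensor⁰ {Γ₁} {Γ₂} (just F) (just G) o₁ o₂ =
  inj₂ (tensor F G (⊢cf⁰-nonempty Γ₁ o₁) (⊢cf⁰-nonempty Γ₂ o₂))
tensor⁰ {Γ₁} {Γ₂} (just F) nothing  o₁ o₂ =
  exch⁰ (solve 3 (λ x f y → (x ⊕ f) ⊕ y ⊕ id ⊜ x ⊕ y ⊕ f) ↭-refl Γ₁ [ F ] Γ₂) (mix⁰ o₁ o₂)
tensor⁰ {Γ₁} {Γ₂} nothing  mG       o₁ o₂ =
  exch⁰ (solve 3 (λ x y g → (x ⊕ id) ⊕ y ⊕ g ⊜ x ⊕ y ⊕ g) ↭-refl Γ₁ Γ₂ (catMaybes [ mG ])) (mix⁰ o₁ o₂)

par⁰ : ∀ mF mG → ⊢cf⁰ Γ ++ catMaybes (mF ∷ mG ∷ []) → ⊢cf⁰ Γ ++ catMaybes [ joinWith _⅋_ mF mG ]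
par⁰ {Γ} (just F) (just G) o = inj₂ (par F G (⊢cf⁰-nonempty Γ o))
par⁰     (just F) nothing  o = o
par⁰     nothing  mG       o = o

module Restriction (s : Atom → Bool) where

  keepIf : Bool → Formula → Maybe Formula
  keepIf true  F = just F
  keepIf false F = nothing

  restrict : Formula → Maybe Formula
  restrict (pos a) = keepIf (s a) (pos a)
  restrict (neg a) = keepIf (s a) (neg a)
  restrict (F ⊗ G) = joinWith _⊗_ (restrict F) (restrict G)
  restrict (F ⅋ G) = joinWith _⅋_ (restrict F) (restrict G)

  restrictS : Sequent → Sequent
  restrictS = mapMaybe restrict

  restrictS-++₃ : ∀ Γ₁ Γ₂ Γ₃ → restrictS (Γ₁ ++ Γ₂ ++ Γ₃) ≡ restrictS Γ₁ ++ restrictS Γ₂ ++ restrictS Γ₃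
  restrictS-++₃ Γ₁ Γ₂ Γ₃ =
    trans (mapMaybe-++ restrict Γ₁ (Γ₂ ++ Γ₃)) (cong (restrictS Γ₁ ++_) (mapMaybe-++ restrict Γ₂ Γ₃))

  ⊢cf-restrict : ⊢cf Γ → ⊢cf⁰ restrictS Γ
  ⊢cf-restrict (ax b) with s b
  ... | true  = inj₂ (ax b)
  ... | false = inj₁ refl
  ⊢cf-restrict (exch q d) = exch⁰ (mapMaybe-↭ restrict q) (⊢cf-restrict d)
  ⊢cf-restrict (mix {Γ} {Δ} d e) =
    subst ⊢cf⁰_ (sym (mapMaybe-++ restrict Γ Δ)) (mix⁰ (⊢cf-restrict d) (⊢cf-restrict e))
  ⊢cf-restrict (tensor {Γ₁} {Γ₂} F G d e) =
    subst ⊢cf⁰_ (sym (restrictS-++₃ Γ₁ Γ₂ [ F ⊗ G ]))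
      (tensor⁰ (restrict F) (restrict G)
        (subst ⊢cf⁰_ (mapMaybe-++ restrict Γ₁ [ F ]) (⊢cf-restrict d))
        (subst ⊢cf⁰_ (mapMaybe-++ restrict Γ₂ [ G ]) (⊢cf-restrict e)))
  ⊢cf-restrict (par {Γ} F G d) =
    subst ⊢cf⁰_ (sym (mapMaybe-++ restrict Γ [ F ⅋ G ]))
      (par⁰ (restrict F) (restrict G) (subst ⊢cf⁰_ (mapMaybe-++ restrict Γ (F ∷ G ∷ [])) (⊢cf-restrict d)))

  Keep Drop : Formula → Set
  Keep F = ∀ {a p} → Occ a p F → s a ≡ true
  Drop F = ∀ {a p} → Occ a p F → s a ≡ false

  KeepAll DropAll : Sequent → Set
  KeepAll Γ = ∀ {a p} → OccS a p Γ → s a ≡ true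
  DropAll Γ = ∀ {a p} → OccS a p Γ → s a ≡ false

  restrict-keep : ∀ F → Keep F → restrict F ≡ just F
  restrict-keep (pos a) k rewrite k at-pos = refl
  restrict-keep (neg a) k rewrite k at-neg = refl
  restrict-keep (F ⊗ G) k rewrite restrict-keep F (k ∘ in-⊗ˡ) | restrict-keep G (k ∘ in-⊗ʳ) = refl
  restrict-keep (F ⅋ G) k rewrite restrict-keep F (k ∘ in-⅋ˡ) | restrict-keep G (k ∘ in-⅋ʳ) = refl

  restrict-drop : ∀ F → Drop F → restrict F ≡ nothing
  restrict-drop (pos a) k rewrite k at-pos = refl
  restrict-drop (neg a) k rewrite k at-neg = refl
  restrict-drop (F ⊗ G) k rewrite restrict-drop F (k ∘ in-⊗ˡ) | restrict-drop G (k ∘ in-⊗ʳ) = refl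
  restrict-drop (F ⅋ G) k rewrite restrict-drop F (k ∘ in-⅋ˡ) | restrict-drop G (k ∘ in-⅋ʳ) = refl

  restrictS-keep : ∀ Γ → KeepAll Γ → restrictS Γ ≡ Γ
  restrictS-keep []      k = refl
  restrictS-keep (F ∷ Γ) k rewrite restrict-keep F (k ∘ here) = cong (F ∷_) (restrictS-keep Γ (k ∘ there))

  restrictS-drop : ∀ Γ → DropAll Γ → restrictS Γ ≡ []
  restrictS-drop []      k = refl
  restrictS-drop (F ∷ Γ) k rewrite restrict-drop F (k ∘ here) = restrictS-drop Γ (k ∘ there)

  ⊢cf-restrict-head : ⊢cf Σ → Σ ↭ H ∷ Λ ++ Δ → ∀ {H′} → restrict H ≡ just H′ → KeepAll Λ → DropAll Δ →
    ⊢cf H′ ∷ Λ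
  ⊢cf-restrict-head {H = H} {Λ} {Δ} d q {H′} eq keep drop =
    ⊢cf⁰-nonempty [] (subst ⊢cf⁰_ restrictS-split (exch⁰ (mapMaybe-↭ restrict q) (⊢cf-restrict d)))
    where
    restrictS-split : restrictS (H ∷ Λ ++ Δ) ≡ H′ ∷ Λ
    restrictS-split = begin
      restrictS (H ∷ Λ ++ Δ)          ≡⟨ cong (λ m → catMaybes (m ∷ map restrict (Λ ++ Δ))) eq ⟩
      H′ ∷ restrictS (Λ ++ Δ)         ≡⟨ cong (H′ ∷_) (mapMaybe-++ restrict Λ Δ) ⟩
      H′ ∷ restrictS Λ ++ restrictS Δ ≡⟨ cong₂ (λ Λ′ Δ′ → H′ ∷ Λ′ ++ Δ′) (restrictS-keep Λ keep) (restrictS-drop Δ drop) ⟩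
      H′ ∷ Λ ++ []                    ≡⟨ cong (H′ ∷_) (++-identityʳ Λ) ⟩
      H′ ∷ Λ                          ∎
      where open ≡-Reasoning

open Restriction

countS-positive : Balanced Γ → ∀ p → countS p a Γ ≡ countS positive a Γ
countS-positive bal positive = refl
countS-positive bal negative = sym (balance bal _)

-- Only positive occurrences are checked, which suffices for balanced Δ.
outside : Sequent → Atom → Bool
outside Δ a = countS positive a Δ ≡ᵇ 0

outside-drops : Balanced Δ → DropAll (outside Δ) Δ
outside-drops bal {p = p} o = positive⇒≢0 (subst (0 <_) (countS-positive bal p) (OccS⇒countS o))
  where
  positive⇒≢0 : ∀ {n} → 0 < n → (n ≡ᵇ 0) ≡ false
  positive⇒≢0 (s≤s _) = refl

m+n≤1⇒n≡0 : ∀ {m n} → 0 < m → m + n ≤ 1 → n ≡ 0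
m+n≤1⇒n≡0 {suc m} _ (s≤s m+n≤0) = m+n≡0⇒n≡0 m (n≤0⇒n≡0 m+n≤0)

-- Every atom of Δ occurs in it with both polarities, so linearity of Λ ++ Δ
-- leaves no occurrence of it for Λ.
outside-keeps : ∀ Λ {Δ} → Linear (Λ ++ Δ) → Balanced Δ → KeepAll (outside Δ) Λ
outside-keeps Λ {Δ} lin bal {a} {p} o
  rewrite sym (countS-positive {a = a} bal p)
        | m+n≤1⇒n≡0 (OccS⇒countS o) (subst (_≤ 1) (countS-++ p a Λ Δ) (at-most-once lin p a)) = refl

fplug-nonliteral : ∀ K → ¬ IsLiteral (fplug K (F ⊗ G))
fplug-nonliteral hole     ()
fplug-nonliteral (K ⊗ₗ B) ()
fplug-nonliteral (B ⊗ᵣ K) ()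
fplug-nonliteral (K ⅋ₗ B) ()
fplug-nonliteral (B ⅋ᵣ K) ()


module Reassociation (A B C : Formula) where

  X₀ X₁ X₂ : Formula
  X₀ = A ⊗ (B ⊗ C)
  X₁ = A ⊗ (B ⅋ C)
  X₂ = A ⅋ (B ⊗ C)

  X₀⊩X₁ : X₀ ⊩ X₁
  X₀⊩X₁ = ⊗-⊩ (⊩-refl A) (⊗-⊩-⅋ B C)

  X₀⊩X₂ : X₀ ⊩ X₂
  X₀⊩X₂ = ⊗-⊩-⅋ A (B ⊗ C)

  fplug-Occ-X₂⇒X₁ : ∀ K {p} → Occ a p (fplug K X₂) → Occ a p (fplug K X₁)
  fplug-Occ-X₂⇒X₁ K = fplug-Occ K λ
    { (in-⅋ˡ o)         → in-⊗ˡ o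
    ; (in-⅋ʳ (in-⊗ˡ o)) → in-⊗ʳ (in-⅋ˡ o)
    ; (in-⅋ʳ (in-⊗ʳ o)) → in-⊗ʳ (in-⅋ʳ o)
    }

  Motive : FCtx → Sequent → Set
  Motive K Γ = Linear (fplug K X₁ ∷ Γ) → ⊢cf fplug K X₂ ∷ Γ → ⊢cf fplug K X₀ ∷ Γ

  reassociate : ∀ K → ⊢cf Σ → Σ ↭ fplug K X₁ ∷ Γ → Motive K Γ
  analysis : ∀ K → Analysis (fplug K X₁) (Motive K)

  reassociate K = analyse (analysis K)

  resp-↭-case : ∀ K → Γ ↭ Γ′ → Motive K Γ → Motive K Γ′
  resp-↭-case K q t lin e =
    exch (↭-prep _ q) (t (Linear-resp-↭ (↭-prep _ (↭-sym q)) lin) (exch (↭-prep _ (↭-sym q)) e))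

  mix-left-case : ∀ K → Motive K Γ₁ → ⊢cf Γ₂ → Motive K (Γ₁ ++ Γ₂)
  mix-left-case {Γ₁} {Γ₂} K t d lin e = mix (t (Linear-++⁻ˡ (fplug K X₁ ∷ Γ₁) lin) e′) d
    where
    keep : KeepAll (outside Γ₂) (fplug K X₁ ∷ Γ₁)
    keep = outside-keeps (fplug K X₁ ∷ Γ₁) lin (balanced d)
    e′ : ⊢cf fplug K X₂ ∷ Γ₁
    e′ = ⊢cf-restrict-head (outside Γ₂) e ↭-refl
           (restrict-keep (outside Γ₂) _ (keep ∘ here ∘ fplug-Occ-X₂⇒X₁ K)) (keep ∘ there) (outside-drops (balanced d))

  mix-right-case : ∀ K → ⊢cf Γ₁ → Motive K Γ₂ → Motive K (Γ₁ ++ Γ₂)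
  mix-right-case {Γ₁} {Γ₂} K d t lin e =
    exch (shift _ Γ₁ Γ₂) (mix d (t (Linear-++⁻ˡ (fplug K X₁ ∷ Γ₂) lin′) e′))
    where
    swap-sides : ∀ Z → Z ∷ Γ₁ ++ Γ₂ ↭ (Z ∷ Γ₂) ++ Γ₁
    swap-sides Z = ↭-prep Z (++-comm Γ₁ Γ₂)
    lin′ : Linear ((fplug K X₁ ∷ Γ₂) ++ Γ₁)
    lin′ = Linear-resp-↭ (swap-sides _) lin
    keep : KeepAll (outside Γ₁) (fplug K X₁ ∷ Γ₂)
    keep = outside-keeps (fplug K X₁ ∷ Γ₂) lin′ (balanced d)
    e′ : ⊢cf fplug K X₂ ∷ Γ₂
    e′ = ⊢cf-restrict-head (outside Γ₁) e (swap-sides _)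
           (restrict-keep (outside Γ₁) _ (keep ∘ here ∘ fplug-Occ-X₂⇒X₁ K)) (keep ∘ there) (outside-drops (balanced d))

  tensor-left-case : ∀ K F G → Motive K (Γ₁ ++ [ F ]) → ⊢cf Γ₂ ++ [ G ] → Motive K (Γ₁ ++ Γ₂ ++ [ F ⊗ G ])
  tensor-left-case {Γ₁} {Γ₂} K F G t d lin e =
    tensor {fplug K X₀ ∷ Γ₁} F G (t (Linear-++⁻ˡ (fplug K X₁ ∷ Γ₁ ++ [ F ]) lin′) e′) d
    where
    s = outside (Γ₂ ++ [ G ])
    to-front : ∀ Z → Z ∷ Γ₁ ++ Γ₂ ++ [ F ⊗ G ] ↭ F ⊗ G ∷ (Z ∷ Γ₁) ++ Γ₂
    to-front Z = solve 4 (λ z x y h → z ⊕ x ⊕ y ⊕ h ⊜ h ⊕ (z ⊕ x) ⊕ y) ↭-refl [ Z ] Γ₁ Γ₂ [ F ⊗ G ]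
    lin′ : Linear ((fplug K X₁ ∷ Γ₁ ++ [ F ]) ++ Γ₂ ++ [ G ])
    lin′ = Linear-resp-≈ᵃ (≈ᵃ-⊗ (to-front _)
             (solve 5 (λ f g z x y → f ⊕ g ⊕ (z ⊕ x) ⊕ y ⊜ (z ⊕ x ⊕ f) ⊕ y ⊕ g) ↭-refl
               [ F ] [ G ] [ fplug K X₁ ] Γ₁ Γ₂)) lin
    keep : KeepAll s (fplug K X₁ ∷ Γ₁ ++ [ F ])
    keep = outside-keeps (fplug K X₁ ∷ Γ₁ ++ [ F ]) lin′ (balanced d)
    drop : DropAll s (Γ₂ ++ [ G ])
    drop = outside-drops (balanced d)
    keep-F-drop-G : restrict s (F ⊗ G) ≡ just F
    keep-F-drop-G rewrite restrict-keep s F (keep ∘ there ∘ ++⁺ʳ Γ₁ ∘ here)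
                        | restrict-drop s G (drop ∘ ++⁺ʳ Γ₂ ∘ here) = refl
    keep-main : KeepAll s (fplug K X₂ ∷ Γ₁)
    keep-main (here o)  = keep (here (fplug-Occ-X₂⇒X₁ K o))
    keep-main (there o) = keep (there (++⁺ˡ o))
    e′ : ⊢cf fplug K X₂ ∷ Γ₁ ++ [ F ]
    e′ = exch (∷↭∷ʳ F (fplug K X₂ ∷ Γ₁))
           (⊢cf-restrict-head s e (to-front _) keep-F-drop-G keep-main (drop ∘ ++⁺ˡ))

  tensor-right-case : ∀ K F G → ⊢cf Γ₁ ++ [ F ] → Motive K (Γ₂ ++ [ G ]) → Motive K (Γ₁ ++ Γ₂ ++ [ F ⊗ G ])
  tensor-right-case {Γ₁} {Γ₂} K F G d t lin e =
    exch (solve 4 (λ x z y h → x ⊕ (z ⊕ y) ⊕ h ⊜ z ⊕ x ⊕ y ⊕ h) ↭-refl Γ₁ [ fplug K X₀ ] Γ₂ [ F ⊗ G ])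
      (tensor {Γ₁} {fplug K X₀ ∷ Γ₂} F G d (t (Linear-++⁻ˡ (fplug K X₁ ∷ Γ₂ ++ [ G ]) lin′) e′))
    where
    s = outside (Γ₁ ++ [ F ])
    to-front : ∀ Z → Z ∷ Γ₁ ++ Γ₂ ++ [ F ⊗ G ] ↭ F ⊗ G ∷ (Z ∷ Γ₂) ++ Γ₁
    to-front Z = solve 4 (λ z x y h → z ⊕ x ⊕ y ⊕ h ⊜ h ⊕ (z ⊕ y) ⊕ x) ↭-refl [ Z ] Γ₁ Γ₂ [ F ⊗ G ]
    lin′ : Linear ((fplug K X₁ ∷ Γ₂ ++ [ G ]) ++ Γ₁ ++ [ F ])
    lin′ = Linear-resp-≈ᵃ (≈ᵃ-⊗ (to-front _)
             (solve 5 (λ f g z y x → f ⊕ g ⊕ (z ⊕ y) ⊕ x ⊜ (z ⊕ y ⊕ g) ⊕ x ⊕ f) ↭-refl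
               [ F ] [ G ] [ fplug K X₁ ] Γ₂ Γ₁)) lin
    keep : KeepAll s (fplug K X₁ ∷ Γ₂ ++ [ G ])
    keep = outside-keeps (fplug K X₁ ∷ Γ₂ ++ [ G ]) lin′ (balanced d)
    drop : DropAll s (Γ₁ ++ [ F ])
    drop = outside-drops (balanced d)
    drop-F-keep-G : restrict s (F ⊗ G) ≡ just G
    drop-F-keep-G rewrite restrict-drop s F (drop ∘ ++⁺ʳ Γ₁ ∘ here)
                        | restrict-keep s G (keep ∘ there ∘ ++⁺ʳ Γ₂ ∘ here) = refl
    keep-main : KeepAll s (fplug K X₂ ∷ Γ₂)
    keep-main (here o)  = keep (here (fplug-Occ-X₂⇒X₁ K o))
    keep-main (there o) = keep (there (++⁺ˡ o))
    e′ : ⊢cf fplug K X₂ ∷ Γ₂ ++ [ G ]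
    e′ = exch (∷↭∷ʳ G (fplug K X₂ ∷ Γ₂))
           (⊢cf-restrict-head s e (to-front _) drop-F-keep-G keep-main (drop ∘ ++⁺ˡ))

  par-side-case : ∀ K F G → Motive K (Γ ++ F ∷ G ∷ []) → Motive K (Γ ++ [ F ⅋ G ])
  par-side-case {Γ} K F G t lin e = par {fplug K X₀ ∷ Γ} F G (t lin′ e′)
    where
    to-front : ∀ Z → Z ∷ Γ ++ [ F ⅋ G ] ↭ F ⅋ G ∷ Z ∷ Γ
    to-front Z = ↭-rotate (Z ∷ Γ) (F ⅋ G)
    to-back : ∀ Z → F ∷ G ∷ Z ∷ Γ ↭ Z ∷ Γ ++ F ∷ G ∷ []
    to-back Z = solve 3 (λ fg z x → fg ⊕ z ⊕ x ⊜ z ⊕ x ⊕ fg) ↭-refl (F ∷ G ∷ []) [ Z ] Γ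
    lin′ : Linear (fplug K X₁ ∷ Γ ++ F ∷ G ∷ [])
    lin′ = Linear-resp-≈ᵃ (≈ᵃ-⅋ (to-front _) (to-back _)) lin
    e′ : ⊢cf fplug K X₂ ∷ Γ ++ F ∷ G ∷ []
    e′ = exch (to-back _) (⅋-inv e (to-front _))

  tensor-main-case : ∀ K F G → fplug K X₁ ≡ F ⊗ G → ⊢cf Γ₁ ++ [ F ] → ⊢cf Γ₂ ++ [ G ] → Motive K (Γ₁ ++ Γ₂)
  tensor-main-case {Γ₁} {Γ₂} hole _ _ refl d₁ d₂ lin e =
    exch (↭-rotate₂ Γ₁ Γ₂ X₀) (tensor A (B ⊗ C) d₁ (exch (∷↭∷ʳ (B ⊗ C) Γ₂) e′))
    where
    s = outside (Γ₁ ++ [ A ])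
    lin′ : Linear ((Γ₂ ++ [ B ⅋ C ]) ++ Γ₁ ++ [ A ])
    lin′ = Linear-resp-≈ᵃ (≈ᵃ-⊗ ↭-refl
             (solve 4 (λ a bc x y → a ⊕ bc ⊕ x ⊕ y ⊜ (y ⊕ bc) ⊕ x ⊕ a) ↭-refl [ A ] [ B ⅋ C ] Γ₁ Γ₂)) lin
    keep : KeepAll s (Γ₂ ++ [ B ⅋ C ])
    keep = outside-keeps (Γ₂ ++ [ B ⅋ C ]) lin′ (balanced d₁)
    drop : DropAll s (Γ₁ ++ [ A ])
    drop = outside-drops (balanced d₁)
    drop-A-keep-BC : restrict s X₂ ≡ just (B ⊗ C)
    drop-A-keep-BC rewrite restrict-drop s A (drop ∘ ++⁺ʳ Γ₁ ∘ here)
                         | restrict-keep s B (keep ∘ ++⁺ʳ Γ₂ ∘ here ∘ in-⅋ˡ)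
                         | restrict-keep s C (keep ∘ ++⁺ʳ Γ₂ ∘ here ∘ in-⅋ʳ) = refl
    e′ : ⊢cf B ⊗ C ∷ Γ₂
    e′ = ⊢cf-restrict-head s e (↭-prep X₂ (++-comm Γ₁ Γ₂)) drop-A-keep-BC (keep ∘ ++⁺ˡ) (drop ∘ ++⁺ˡ)
  tensor-main-case {Γ₁} {Γ₂} (K ⊗ₗ H) _ _ refl d₁ d₂ lin e =
    exch (↭-rotate₂ Γ₁ Γ₂ _) (tensor (fplug K X₀) H (exch (∷↭∷ʳ _ Γ₁) r) d₂)
    where
    s = outside (Γ₂ ++ [ H ])
    lin′ : Linear ((fplug K X₁ ∷ Γ₁) ++ Γ₂ ++ [ H ])
    lin′ = Linear-resp-≈ᵃ (≈ᵃ-⊗ ↭-refl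
             (solve 4 (λ k h x y → k ⊕ h ⊕ x ⊕ y ⊜ (k ⊕ x) ⊕ y ⊕ h) ↭-refl [ fplug K X₁ ] [ H ] Γ₁ Γ₂)) lin
    keep : KeepAll s (fplug K X₁ ∷ Γ₁)
    keep = outside-keeps (fplug K X₁ ∷ Γ₁) lin′ (balanced d₂)
    drop : DropAll s (Γ₂ ++ [ H ])
    drop = outside-drops (balanced d₂)
    keep-K-drop-H : restrict s (fplug K X₂ ⊗ H) ≡ just (fplug K X₂)
    keep-K-drop-H rewrite restrict-keep s (fplug K X₂) (keep ∘ here ∘ fplug-Occ-X₂⇒X₁ K)
                        | restrict-drop s H (drop ∘ ++⁺ʳ Γ₂ ∘ here) = refl
    r : ⊢cf fplug K X₀ ∷ Γ₁
    r = reassociate K d₁ (↭-rotate Γ₁ _) (Linear-++⁻ˡ (fplug K X₁ ∷ Γ₁) lin′)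
          (⊢cf-restrict-head s e ↭-refl keep-K-drop-H (keep ∘ there) (drop ∘ ++⁺ˡ))
  tensor-main-case {Γ₁} {Γ₂} (H ⊗ᵣ K) _ _ refl d₁ d₂ lin e =
    exch (↭-rotate₂ Γ₁ Γ₂ _) (tensor H (fplug K X₀) d₁ (exch (∷↭∷ʳ _ Γ₂) r))
    where
    s = outside (Γ₁ ++ [ H ])
    lin′ : Linear ((fplug K X₁ ∷ Γ₂) ++ Γ₁ ++ [ H ])
    lin′ = Linear-resp-≈ᵃ (≈ᵃ-⊗ ↭-refl
             (solve 4 (λ h k x y → h ⊕ k ⊕ x ⊕ y ⊜ (k ⊕ y) ⊕ x ⊕ h) ↭-refl [ H ] [ fplug K X₁ ] Γ₁ Γ₂)) lin
    keep : KeepAll s (fplug K X₁ ∷ Γ₂)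
    keep = outside-keeps (fplug K X₁ ∷ Γ₂) lin′ (balanced d₁)
    drop : DropAll s (Γ₁ ++ [ H ])
    drop = outside-drops (balanced d₁)
    drop-H-keep-K : restrict s (H ⊗ fplug K X₂) ≡ just (fplug K X₂)
    drop-H-keep-K rewrite restrict-drop s H (drop ∘ ++⁺ʳ Γ₁ ∘ here)
                        | restrict-keep s (fplug K X₂) (keep ∘ here ∘ fplug-Occ-X₂⇒X₁ K) = refl
    r : ⊢cf fplug K X₀ ∷ Γ₂
    r = reassociate K d₂ (↭-rotate Γ₂ _) (Linear-++⁻ˡ (fplug K X₁ ∷ Γ₂) lin′)
          (⊢cf-restrict-head s e (↭-prep _ (++-comm Γ₁ Γ₂)) drop-H-keep-K (keep ∘ there) (drop ∘ ++⁺ˡ))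

  par-main-case : ∀ K F G → fplug K X₁ ≡ F ⅋ G → ⊢cf Γ ++ F ∷ G ∷ [] → Motive K Γ
  par-main-case {Γ} (K ⅋ₗ H) _ _ refl d lin e =
    exch (↭-rotate Γ _) (par (fplug K X₀) H (exch (↭-sym (to-front _)) r))
    where
    to-front : ∀ Z → Γ ++ Z ∷ H ∷ [] ↭ Z ∷ H ∷ Γ
    to-front Z = solve 2 (λ x zh → x ⊕ zh ⊜ zh ⊕ x) ↭-refl Γ (Z ∷ H ∷ [])
    r : ⊢cf fplug K X₀ ∷ H ∷ Γ
    r = reassociate K d (to-front _) (Linear-resp-≈ᵃ ⅋-≈ᵃ lin) (⅋-inv e ↭-refl)
  par-main-case {Γ} (H ⅋ᵣ K) _ _ refl d lin e =
    exch (↭-rotate Γ _) (par H (fplug K X₀) (exch (↭-sym (to-front _)) r))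
    where
    to-front : ∀ Z → Γ ++ H ∷ Z ∷ [] ↭ Z ∷ H ∷ Γ
    to-front Z = solve 3 (λ x h z → x ⊕ h ⊕ z ⊜ z ⊕ h ⊕ x) ↭-refl Γ [ H ] [ Z ]
    r : ⊢cf fplug K X₀ ∷ H ∷ Γ
    r = reassociate K d (to-front _) (Linear-resp-↭ (↭-swap _ _ ↭-refl) (Linear-resp-≈ᵃ ⅋-≈ᵃ lin))
          (exch (↭-swap _ _ ↭-refl) (⅋-inv e ↭-refl))

  analysis K = record
    { T-resp-↭     = resp-↭-case K
    ; mix-left     = mix-left-case K
    ; mix-right    = mix-right-case K
    ; tensor-left  = tensor-left-case K
    ; tensor-right = tensor-right-case K
    ; par-side     = par-side-case K
    ; axiom        = λ lit → ⊥-elim (fplug-nonliteral K lit)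
    ; tensor-main  = tensor-main-case K
    ; par-main     = par-main-case K
    }

  ⊢-plug-reassociate : ∀ D → Binary (toList (plug D X₀)) →
    ⊢ toList (plug D X₁) → ⊢ toList (plug D X₂) → ⊢ toList (plug D X₀)
  ⊢-plug-reassociate D@(sctx L K R) bin d₁ d₂
    rewrite toList-plug D X₀ | toList-plug D X₁ | toList-plug D X₂ =
    ⊢cf⇒⊢ (exch (↭-sym (shift _ L R))
      (reassociate K (cut-elimination d₁) (shift _ L R) lin (exch (shift _ L R) (cut-elimination d₂))))
    where
    lin : Linear (fplug K X₁ ∷ L ++ R)
    lin = Linear-resp-≈ᵃ (≈ᵃ-trans (↭⇒≈ᵃ (shift _ L R)) (fplug-≈ᵃ K (mk≈ᵃ λ { positive _ → refl ; negative _ → refl })))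
            (Binary⇒Linear (subst Binary (toList-plug D X₀) bin))

lemma3 : (D : SCtx) (A B C : Formula) →
    Binary (toList (plug D (A ⊗ (B ⊗ C)))) →
    ((⊢ [ plug D (A ⊗ (B ⊗ C)) ⊸ₛ plug D (A ⊗ (B ⅋ C)) ])
      × (⊢ [ plug D (A ⊗ (B ⊗ C)) ⊸ₛ plug D (A ⅋ (B ⊗ C)) ]))
    × ((⊢ toList (plug D (A ⊗ (B ⊗ C))))
      ⇔ ((⊢ toList (plug D (A ⊗ (B ⅋ C)))) × (⊢ toList (plug D (A ⅋ (B ⊗ C))))))
lemma3 D A B C bin =
  (⊸ₛ-plug-mono D X₀⊩X₁ , ⊸ₛ-plug-mono D X₀⊩X₂) ,
  mk⇔ (λ d → ⊢-plug-mono D X₀⊩X₁ d , ⊢-plug-mono D X₀⊩X₂ d)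
      (λ (d₁ , d₂) → ⊢-plug-reassociate D bin d₁ d₂)
  where
  open Reassociation A B C
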